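{- If $G$ is a $4$-regular $K_{1,3}$-induced-saturated graph on $n$ vertices, then $n \equiv 0 \pmod 3$.
   Context: All graphs are finite and simple. For a graph $H$, a graph $G$ is $H$-induced-saturated if $G$ contains no induced subgraph isomorphic to $H$, but for every pair of distinct vertices $u,v$ of $G$, the graph obtained from $G$ by adding the edge $uv$ (if $uv\notin E(G)$) or deleting it (if $uv\in E(G)$) contains an induced subgraph isomorphic to $H$. -}

module Defs where

open import Data.Nat using (ℕ)
open import Data.Bool using (Bool; true; false; not; if_then_else_; _∧_; _∨_)
open import Data.Bool.Properties using () renaming (_≟_ to _≟ᵇ_)
open import Data.Fin using (Fin)
open import Data.Fin.Properties using (_≟_)
open import Data.Product using (_×_; ∃-syntax)
open import Data.List using (length; filter; allFin)
open import Relation.Nullary using (¬_; does)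
open import Relation.Binary.PropositionalEquality using (_≡_)

Adj : ℕ → Set
Adj n = Fin n → Fin n → Bool

record Graph (n : ℕ) : Set where
  field
    adj    : Adj n
    sym    : ∀ u v → adj u v ≡ adj v u
    irrefl : ∀ v → adj v v ≡ false
open Graph public

degree : ∀ {n} → Graph n → Fin n → ℕ
degree {n} G v = length (filter (λ w → adj G v w ≟ᵇ true) (allFin n))

Regular : ∀ {n} → ℕ → Graph n → Set
Regular k G = ∀ v → degree G v ≡ k

HasInducedClaw : ∀ {n} → Adj n → Set
HasInducedClaw {n} E =
  ∃[ c ] ∃[ a ] ∃[ b ] ∃[ d ]
    (¬ a ≡ b × ¬ a ≡ d × ¬ b ≡ d × ¬ c ≡ a × ¬ c ≡ b × ¬ c ≡ d
    × E c a ≡ true × E c b ≡ true × E c d ≡ true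
    × E a b ≡ false × E a d ≡ false × E b d ≡ false)

toggle : ∀ {n} → Adj n → Fin n → Fin n → Adj n
toggle E u v x y =
  if (does (x ≟ u) ∧ does (y ≟ v)) ∨ (does (x ≟ v) ∧ does (y ≟ u))
  then not (E x y) else E x y

ClawInducedSaturated : ∀ {n} → Graph n → Set
ClawInducedSaturated {n} G =
  ¬ HasInducedClaw (adj G)
  × (∀ (u v : Fin n) → ¬ u ≡ v → HasInducedClaw (toggle (adj G) u v))

-- A triangle abc is special when one of its edges has the opposite vertex as its
-- only common neighbour. In a 4-regular K_{1,3}-induced-saturated graph every edge
-- lies in exactly one special triangle. Deleting an edge must create a claw, so every
-- edge lies in a triangle; adding a non-edge must create a claw, so non-adjacent
-- vertices have at most two common neighbours. With 4-regularity this excludes K₄,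
-- hence an edge has at most two common neighbours, and when it has two they span a
-- diamond whose remaining neighbours determine which of its two triangles is special.
-- Counting ordered triples (a, b, c) with abc special therefore gives Σₐ deg a = 4n;
-- these triples fall into rotation classes of size three, so 3 ∣ 4n and 3 ∣ n.

module Submission where

open import Defs hiding (sym)
open import Data.Bool using (Bool; true; false; not)
open import Data.Bool.Properties using (not-¬) renaming (_≟_ to _≟ᵇ_)
open import Data.Empty using (⊥; ⊥-elim)
open import Data.Fin using (Fin; zero; suc; _<_; _<?_)
open import Data.Fin.Properties using (_≟_; suc-injective; <-cmp; <-trans; <-asym; any?; all?)
open import Data.List as List using (List; []; _∷_; _++_; length; filter; allFin)
open import Data.List.Properties using (length-++-sucʳ)
open import Data.List.Membership.Propositional using (_∈_; _∉_; find)
open import Data.List.Membership.Propositional.Properties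
  using (∈-∃++; ∈-++⁻; ∈-++⁺ˡ; ∈-++⁺ʳ; ∈-filter⁺; ∈-filter⁻; ∈-allFin)
open import Data.List.Relation.Unary.All as All using (All; []; _∷_)
open import Data.List.Relation.Unary.All.Properties using (¬Any⇒All¬; ¬All⇒Any¬)
open import Data.List.Relation.Unary.Any using (here; there)
open import Data.List.Relation.Unary.Unique.Propositional using (Unique; []; _∷_)
open import Data.List.Relation.Unary.Unique.Propositional.Properties using (filter⁺; allFin⁺)
open import Data.Nat using (ℕ; zero; suc; _+_; _*_; _≤_; z≤n; s≤s; s≤s⁻¹)
open import Data.Nat.Divisibility using (_∣_; divides; ∣m+n∣m⇒∣n; n∣m*n; n∣m⇒m%n≡0)
open import Data.Nat.DivMod using (_%_)
open import Data.Nat.Properties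
  using ( +-0-commutativeMonoid; +-identityʳ; *-identityˡ; *-zeroʳ; *-suc; +-comm
        ; ≤-reflexive; <⇒≱; <-irrefl; module ≤-Reasoning)
open import Data.Nat.Tactic.RingSolver using (solve-∀)
open import Algebra.Properties.CommutativeMonoid.Sum +-0-commutativeMonoid
  using (sum; sum-syntax; ∑-distrib-+; ∑-comm; sum-cong-≗; sum-replicate-zero)
open import Data.Product using (_×_; _,_; proj₁; proj₂; ∃-syntax; ∃!)
open import Data.Sum using (_⊎_; inj₁; inj₂; [_,_]; [_,_]′)
open import Function using (_∘_; id; mk⇔)
open import Relation.Binary using (tri<; tri≈; tri>)
open import Relation.Binary.PropositionalEquality
  using (_≡_; _≢_; refl; sym; trans; cong; cong₂; subst; module ≡-Reasoning)
open import Relation.Nullary using (¬_; Dec; yes; no; does)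
open import Relation.Nullary.Decidable
  using (_×-dec_; _⊎-dec_; _→-dec_; ¬?; dec-true; dec-false; does-⇔)
open import Relation.Nullary.Negation using (contradiction)

𝟙 : Bool → ℕ
𝟙 true = 1
𝟙 false = 0

∑-const : ∀ n k → ∑[ i < n ] k ≡ n * k
∑-const zero k = refl
∑-const (suc n) k = cong (k +_) (∑-const n k)

∑-supported-at : ∀ {n} (f : Fin n → ℕ) x → (∀ y → y ≢ x → f y ≡ 0) → sum f ≡ f x
∑-supported-at {suc n} f zero f≡0 = begin
  f zero + ∑[ y < n ] f (suc y) ≡⟨ cong (f zero +_) (sum-cong-≗ λ y → f≡0 (suc y) λ ()) ⟩
  f zero + ∑[ y < n ] 0         ≡⟨ cong (f zero +_) (sum-replicate-zero n) ⟩
  f zero + 0                    ≡⟨ +-identityʳ (f zero) ⟩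
  f zero                        ∎
  where open ≡-Reasoning
∑-supported-at {suc n} f (suc x) f≡0 =
  cong₂ _+_ (f≡0 zero λ ())
            (∑-supported-at (f ∘ suc) x λ y y≢x → f≡0 (suc y) (y≢x ∘ suc-injective))

∑³ : ∀ {n} → (Fin n → Fin n → Fin n → ℕ) → ℕ
∑³ {n} f = ∑[ a < n ] ∑[ b < n ] ∑[ c < n ] f a b c

∑³-cong : ∀ {n} {f g : Fin n → Fin n → Fin n → ℕ} → (∀ a b c → f a b c ≡ g a b c) → ∑³ f ≡ ∑³ g
∑³-cong f≡g = sum-cong-≗ λ a → sum-cong-≗ λ b → sum-cong-≗ (f≡g a b)

∑³-distrib-+ : ∀ {n} (f g : Fin n → Fin n → Fin n → ℕ) →
               ∑³ (λ a b c → f a b c + g a b c) ≡ ∑³ f + ∑³ g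
∑³-distrib-+ {n} f g =
  trans (sum-cong-≗ λ a →
           trans (sum-cong-≗ λ b → ∑-distrib-+ (f a b) (g a b))
                 (∑-distrib-+ (λ b → sum (f a b)) (λ b → sum (g a b))))
        (∑-distrib-+ (λ a → ∑[ b < n ] sum (f a b)) (λ a → ∑[ b < n ] sum (g a b)))

∑³-rotate : ∀ {n} (f : Fin n → Fin n → Fin n → ℕ) → ∑³ (λ a b c → f b c a) ≡ ∑³ f
∑³-rotate {n} f =
  trans (∑-comm (λ a b → ∑[ c < n ] f b c a)) (sum-cong-≗ λ b → ∑-comm (λ a c → f b c a))

length-filter-tabulate : ∀ {a} {A : Set a} (p : A → Bool) {m} (g : Fin m → A) →
  length (filter (λ x → p x ≟ᵇ true) (List.tabulate g)) ≡ ∑[ i < m ] 𝟙 (p (g i))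
length-filter-tabulate p {zero}  g = refl
length-filter-tabulate p {suc m} g with p (g zero)
... | true  = cong suc (length-filter-tabulate p (g ∘ suc))
... | false = length-filter-tabulate p (g ∘ suc)

Least : ∀ {n} → Fin n → Fin n → Fin n → Set
Least a b c = a < b × a < c

least? : ∀ {n} (a b c : Fin n) → Dec (Least a b c)
least? a b c = (a <? b) ×-dec (a <? c)

some-rotation-least : ∀ {n} {a b c : Fin n} → a ≢ b → b ≢ c → c ≢ a →
                      Least a b c ⊎ Least b c a ⊎ Least c a b
some-rotation-least {a = a} {b} {c} a≢b b≢c c≢a with <-cmp a b
... | tri≈ _ a≡b _ = contradiction a≡b a≢b
... | tri< a<b _ _ with <-cmp a c
...   | tri< a<c _ _ = inj₁ (a<b , a<c)
...   | tri≈ _ a≡c _ = contradiction (sym a≡c) c≢a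
...   | tri> _ _ c<a = inj₂ (inj₂ (c<a , <-trans c<a a<b))
some-rotation-least {a = a} {b} {c} a≢b b≢c c≢a | tri> _ _ b<a with <-cmp b c
...   | tri< b<c _ _ = inj₂ (inj₁ (b<c , b<a))
...   | tri≈ _ b≡c _ = contradiction b≡c b≢c
...   | tri> _ _ c<b = inj₂ (inj₂ (<-trans c<b b<a , c<b))

𝟙-exactly-one : ∀ {P Q R : Set} (P? : Dec P) (Q? : Dec Q) (R? : Dec R) →
                P ⊎ Q ⊎ R → ¬ (P × Q) → ¬ (Q × R) → ¬ (R × P) →
                𝟙 (does P?) + 𝟙 (does Q?) + 𝟙 (does R?) ≡ 1
𝟙-exactly-one (yes p) (yes q) _       _ ¬pq _   _   = contradiction (p , q) ¬pq
𝟙-exactly-one (yes p) (no _)  (yes r) _ _   _   ¬rp = contradiction (r , p) ¬rp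
𝟙-exactly-one (no _)  (yes q) (yes r) _ _   ¬qr _   = contradiction (q , r) ¬qr
𝟙-exactly-one (yes _) (no _)  (no _)  _ _   _   _   = refl
𝟙-exactly-one (no _)  (yes _) (no _)  _ _   _   _   = refl
𝟙-exactly-one (no _)  (no _)  (yes _) _ _   _   _   = refl
𝟙-exactly-one (no ¬p) (no ¬q) (no ¬r) pqr _ _ _ = ⊥-elim ([ ¬p , [ ¬q , ¬r ] ] pqr)

one-rotation-least : ∀ {n} {a b c : Fin n} → a ≢ b → b ≢ c → c ≢ a →
  𝟙 (does (least? a b c)) + 𝟙 (does (least? b c a)) + 𝟙 (does (least? c a b)) ≡ 1
one-rotation-least a≢b b≢c c≢a =
  𝟙-exactly-one (least? _ _ _) (least? _ _ _) (least? _ _ _) (some-rotation-least a≢b b≢c c≢a)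
    (λ ((a<b , _) , (_ , b<a)) → <-asym a<b b<a)
    (λ ((b<c , _) , (_ , c<b)) → <-asym b<c c<b)
    (λ ((c<a , _) , (_ , a<c)) → <-asym c<a a<c)

3∣∑³ : ∀ {n} (f : Fin n → Fin n → Fin n → ℕ) →
       (∀ a b c → f a b c ≡ f b c a) → (∀ a c → f a a c ≡ 0) → 3 ∣ ∑³ f
3∣∑³ {n} f rot diag = divides (∑³ m) (begin
  ∑³ f                                          ≡⟨ ∑³-cong split ⟩
  ∑³ (λ a b c → m a b c + mʳ a b c + mʳʳ a b c) ≡⟨ ∑³-distrib-+ (λ a b c → m a b c + mʳ a b c) mʳʳ ⟩
  ∑³ (λ a b c → m a b c + mʳ a b c) + ∑³ mʳʳ    ≡⟨ cong (_+ ∑³ mʳʳ) (∑³-distrib-+ m mʳ) ⟩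
  ∑³ m + ∑³ mʳ + ∑³ mʳʳ                         ≡⟨ cong₂ (λ s t → ∑³ m + s + t) (∑³-rotate m)
                                                         (trans (∑³-rotate mʳ) (∑³-rotate m)) ⟩
  ∑³ m + ∑³ m + ∑³ m                            ≡⟨ thrice (∑³ m) ⟩
  ∑³ m * 3                                      ∎)
  where
  open ≡-Reasoning
  thrice : ∀ x → x + x + x ≡ x * 3
  thrice = solve-∀
  distrib₃ : ∀ p q r x → p * x + q * x + r * x ≡ (p + q + r) * x
  distrib₃ = solve-∀
  -- m keeps a triple only when its first entry is the least, which holds for exactly
  -- one rotation of a triple of distinct entries.
  m mʳ mʳʳ : Fin n → Fin n → Fin n → ℕ
  m a b c = 𝟙 (does (least? a b c)) * f a b c
  mʳ a b c = m b c a
  mʳʳ a b c = m c a b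
  leasts : Fin n → Fin n → Fin n → ℕ
  leasts a b c = 𝟙 (does (least? a b c)) + 𝟙 (does (least? b c a)) + 𝟙 (does (least? c a b))
  rotations : ∀ a b c → m a b c + mʳ a b c + mʳʳ a b c ≡ leasts a b c * f a b c
  rotations a b c rewrite sym (rot a b c) | rot c a b =
    distrib₃ (𝟙 (does (least? a b c))) (𝟙 (does (least? b c a))) (𝟙 (does (least? c a b))) (f a b c)
  vanishing : ∀ a b c → f a b c ≡ 0 → f a b c ≡ m a b c + mʳ a b c + mʳʳ a b c
  vanishing a b c f≡0 = begin
    f a b c                        ≡⟨ f≡0 ⟩
    0                              ≡⟨ *-zeroʳ (leasts a b c) ⟨
    leasts a b c * 0               ≡⟨ cong (leasts a b c *_) f≡0 ⟨
    leasts a b c * f a b c         ≡⟨ rotations a b c ⟨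
    m a b c + mʳ a b c + mʳʳ a b c ∎
  split : ∀ a b c → f a b c ≡ m a b c + mʳ a b c + mʳʳ a b c
  split a b c with a ≟ b | b ≟ c | c ≟ a
  ... | yes refl | _ | _ = vanishing a a c (diag a c)
  ... | _ | yes refl | _ = vanishing a b b (trans (rot a b b) (diag b a))
  ... | _ | _ | yes refl = vanishing a b a (trans (rot a b a) (trans (rot b a a) (diag a b)))
  ... | no a≢b | no b≢c | no c≢a = begin
    f a b c                ≡⟨ *-identityˡ (f a b c) ⟨
    1 * f a b c            ≡⟨ cong (_* f a b c) (one-rotation-least a≢b b≢c c≢a) ⟨
    leasts a b c * f a b c ≡⟨ rotations a b c ⟨
    m a b c + mʳ a b c + mʳʳ a b c ∎

3∣n*4⇒3∣n : ∀ n → 3 ∣ n * 4 → 3 ∣ n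
3∣n*4⇒3∣n n 3∣n*4 =
  ∣m+n∣m⇒∣n (subst (3 ∣_) (trans (*-suc n 3) (+-comm n (n * 3))) 3∣n*4) (n∣m*n n)

module _ {a} {A : Set a} where

  ∈-++-∷⁻ : ∀ {x y : A} as {bs} → x ≢ y → y ∈ as ++ x ∷ bs → y ∈ as ++ bs
  ∈-++-∷⁻ as x≢y y∈ with ∈-++⁻ as y∈
  ... | inj₁ y∈as         = ∈-++⁺ˡ y∈as
  ... | inj₂ (here y≡x)   = contradiction (sym y≡x) x≢y
  ... | inj₂ (there y∈bs) = ∈-++⁺ʳ as y∈bs

  unique-⊆⇒length≤ : ∀ {xs ys : List A} → Unique xs → All (_∈ ys) xs → length xs ≤ length ys
  unique-⊆⇒length≤ [] [] = z≤n
  unique-⊆⇒length≤ {x ∷ xs} (x≢xs ∷ xs!) (x∈ys ∷ xs⊆ys) with ∈-∃++ x∈ys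
  ... | as , bs , refl = begin
    suc (length xs)         ≤⟨ s≤s (unique-⊆⇒length≤ xs! xs⊆as++bs) ⟩
    suc (length (as ++ bs)) ≡⟨ length-++-sucʳ as x bs ⟨
    length (as ++ x ∷ bs)   ∎
    where
    open ≤-Reasoning
    xs⊆as++bs : All (_∈ as ++ bs) xs
    xs⊆as++bs = All.zipWith (λ (x≢y , y∈) → ∈-++-∷⁻ as x≢y y∈) (x≢xs , xs⊆ys)

SamePair : ∀ {n} → Fin n → Fin n → Fin n → Fin n → Set
SamePair u v x y = (x ≡ u × y ≡ v) ⊎ (x ≡ v × y ≡ u)

samePair? : ∀ {n} (u v x y : Fin n) → Dec (SamePair u v x y)
samePair? u v x y = (x ≟ u ×-dec y ≟ v) ⊎-dec (x ≟ v ×-dec y ≟ u)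

SamePair-sym : ∀ {n} {u v x y : Fin n} → SamePair u v x y → SamePair u v y x
SamePair-sym (inj₁ (x≡u , y≡v)) = inj₂ (y≡v , x≡u)
SamePair-sym (inj₂ (x≡v , y≡u)) = inj₁ (y≡u , x≡v)

SamePair-functional : ∀ {n} {u v x y z : Fin n} → u ≢ v →
                      SamePair u v x y → SamePair u v x z → y ≡ z
SamePair-functional _   (inj₁ (refl , refl)) (inj₁ (_ , refl)) = refl
SamePair-functional u≢v (inj₁ (refl , refl)) (inj₂ (u≡v , _))  = contradiction u≡v u≢v
SamePair-functional u≢v (inj₂ (refl , refl)) (inj₁ (v≡u , _))  = contradiction (sym v≡u) u≢v
SamePair-functional _   (inj₂ (refl , refl)) (inj₂ (_ , refl)) = refl

module _ {n} (E : Adj n) {u v : Fin n} where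

  -- The test in toggle is definitionally does (samePair? u v x y).
  toggle-pair : ∀ {x y} → SamePair u v x y → toggle E u v x y ≡ not (E x y)
  toggle-pair {x} {y} p rewrite dec-true (samePair? u v x y) p = refl

  toggle-nonpair : ∀ {x y} → ¬ SamePair u v x y → toggle E u v x y ≡ E x y
  toggle-nonpair {x} {y} ¬p rewrite dec-false (samePair? u v x y) ¬p = refl

pattern 1st = here refl
pattern 2nd = there (here refl)
pattern 3rd = there (there (here refl))
pattern 4th = there (there (there (here refl)))

module _ {n} (G : Graph n) where

  open import Data.List.Membership.DecPropositional (_≟_ {n}) using (_∈?_)

  infix 4 _~_ _≁_ _~?_

  _~_ _≁_ : Fin n → Fin n → Set
  x ~ y = adj G x y ≡ true
  x ≁ y = adj G x y ≡ false

  _~?_ : ∀ x y → Dec (x ~ y)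
  x ~? y = adj G x y ≟ᵇ true

  ~-or-≁ : ∀ x y → x ~ y ⊎ x ≁ y
  ~-or-≁ x y with adj G x y
  ... | true  = inj₁ refl
  ... | false = inj₂ refl

  adj-sym : ∀ {x y b} → adj G x y ≡ b → adj G y x ≡ b
  adj-sym {x} {y} = trans (Graph.sym G y x)

  ~⇒¬≁ : ∀ {x y} → x ~ y → ¬ x ≁ y
  ~⇒¬≁ x~y x≁y = contradiction (trans (sym x~y) x≁y) λ ()

  ~⇒≢ : ∀ {x y} → x ~ y → x ≢ y
  ~⇒≢ {x} x~y refl = ~⇒¬≁ x~y (Graph.irrefl G x)

  ≁∧~⇒≢ : ∀ {x y z} → x ≁ z → y ~ z → x ≢ y
  ≁∧~⇒≢ x≁z y~z refl = ~⇒¬≁ y~z x≁z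

  degree≡∑ : ∀ v → degree G v ≡ ∑[ w < n ] 𝟙 (adj G v w)
  degree≡∑ v = length-filter-tabulate (adj G v) id

  neighbours : Fin n → List (Fin n)
  neighbours v = filter (v ~?_) (allFin n)

  length≤degree : ∀ {v ws} → Unique ws → All (v ~_) ws → length ws ≤ degree G v
  length≤degree {v} ws! v~ws =
    unique-⊆⇒length≤ ws! (All.map (∈-filter⁺ (v ~?_) (∈-allFin _)) v~ws)

  neighbour∈ : ∀ {v w ws} → degree G v ≤ length ws → Unique ws → All (v ~_) ws → v ~ w → w ∈ ws
  neighbour∈ {w = w} {ws} deg≤ ws! v~ws v~w with w ∈? ws
  ... | yes w∈ws = w∈ws
  ... | no  w∉ws = contradiction deg≤ (<⇒≱ (length≤degree (¬Any⇒All¬ ws w∉ws ∷ ws!) (v~w ∷ v~ws)))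

  ∃-neighbour∉ : ∀ {v ws} → suc (length ws) ≤ degree G v → ∃[ w ] v ~ w × w ∉ ws
  ∃-neighbour∉ {v} {ws} |ws|<deg with All.all? (_∈? ws) (neighbours v)
  ... | yes nbrs⊆ws =
    contradiction (unique-⊆⇒length≤ (filter⁺ (v ~?_) (allFin⁺ n)) nbrs⊆ws) (<⇒≱ |ws|<deg)
  ... | no  nbrs⊈ws with find (¬All⇒Any¬ (_∈? ws) (neighbours v) nbrs⊈ws)
  ...   | w , w∈nbrs , w∉ws = w , proj₂ (∈-filter⁻ (v ~?_) {xs = allFin n} w∈nbrs) , w∉ws

  untoggle : ∀ {u v x y b} → ¬ SamePair u v x y → toggle (adj G) u v x y ≡ b → adj G x y ≡ b
  untoggle ¬p = trans (sym (toggle-nonpair (adj G) ¬p))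

  SamePair⇒adj≡ : ∀ {u v x y} → SamePair u v x y → adj G x y ≡ adj G u v
  SamePair⇒adj≡ (inj₁ (refl , refl)) = refl
  SamePair⇒adj≡ (inj₂ (refl , refl)) = Graph.sym G _ _

  toggle-sym : ∀ {u v} x y → toggle (adj G) u v x y ≡ toggle (adj G) u v y x
  toggle-sym {u} {v} x y with samePair? u v x y
  ... | yes p = trans (toggle-pair (adj G) p)
                 (trans (cong not (Graph.sym G x y)) (sym (toggle-pair (adj G) (SamePair-sym p))))
  ... | no ¬p = trans (toggle-nonpair (adj G) ¬p)
                 (trans (Graph.sym G x y) (sym (toggle-nonpair (adj G) (¬p ∘ SamePair-sym))))

  untoggle-pair-value : ∀ {u v x y b} → adj G u v ≡ b → toggle (adj G) u v x y ≡ b → adj G x y ≡ b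
  untoggle-pair-value {u} {v} {x} {y} uv≡b t with samePair? u v x y
  ... | yes p = contradiction (trans (sym t) (trans (toggle-pair (adj G) p) (cong not (trans (SamePair⇒adj≡ p) uv≡b))))
                              (not-¬ refl)
  ... | no ¬p = untoggle ¬p t

  -- Deleting the edge uv can only create a claw with leaves u, v and a neighbour z of
  -- its centre outside N[u] ∪ N[v]; adding the non-edge uv only one centred at u or v.
  ExternalNeighbour : Fin n → Fin n → Fin n → Set
  ExternalNeighbour c u v = ∃[ z ] c ~ z × z ≁ u × z ≁ v × z ≢ u × z ≢ v

  DeletionClaw : Fin n → Fin n → Set
  DeletionClaw u v = ∃[ c ] c ~ u × c ~ v × ExternalNeighbour c u v

  AdditionClaw : Fin n → Fin n → Set
  AdditionClaw u v = ∃[ p ] ∃[ q ] u ~ p × u ~ q × p ≁ v × q ≁ v × p ≁ q × p ≢ q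

  SoleCommonNeighbour : Fin n → Fin n → Fin n → Set
  SoleCommonNeighbour p q r = ∀ w → p ~ w → q ~ w → w ≡ r

  sole? : ∀ p q r → Dec (SoleCommonNeighbour p q r)
  sole? p q r = all? λ w → p ~? w →-dec q ~? w →-dec w ≟ r

  SpecialTriangle : Fin n → Fin n → Fin n → Set
  SpecialTriangle a b c =
    a ~ b × b ~ c × c ~ a ×
    (SoleCommonNeighbour a b c ⊎ SoleCommonNeighbour b c a ⊎ SoleCommonNeighbour c a b)

  special? : ∀ a b c → Dec (SpecialTriangle a b c)
  special? a b c =
    a ~? b ×-dec b ~? c ×-dec c ~? a ×-dec (sole? a b c ⊎-dec sole? b c a ⊎-dec sole? c a b)

  SpecialTriangle-rotate : ∀ {a b c} → SpecialTriangle a b c → SpecialTriangle b c a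
  SpecialTriangle-rotate (a~b , b~c , c~a , sole) =
    b~c , c~a , a~b , [ inj₂ ∘ inj₂ , [ inj₁ , inj₂ ∘ inj₁ ]′ ]′ sole

  3∣∑³-special : 3 ∣ ∑³ (λ a b c → 𝟙 (does (special? a b c)))
  3∣∑³-special = 3∣∑³ _ rotate diagonal
    where
    rotate : ∀ a b c → 𝟙 (does (special? a b c)) ≡ 𝟙 (does (special? b c a))
    rotate a b c =
      cong 𝟙 (does-⇔ (mk⇔ SpecialTriangle-rotate (SpecialTriangle-rotate ∘ SpecialTriangle-rotate))
                     (special? a b c) (special? b c a))
    diagonal : ∀ a c → 𝟙 (does (special? a a c)) ≡ 0
    diagonal a c = cong 𝟙 (dec-false (special? a a c) λ (a~a , _) → ~⇒≢ a~a refl)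

  module _ (sat : ClawInducedSaturated G) where

    claw-free : ∀ {c a b d} → c ~ a → c ~ b → c ~ d → a ≢ b → a ≢ d → b ≢ d →
                a ≁ b → a ≁ d → b ≁ d → ⊥
    claw-free {c} {a} {b} {d} c~a c~b c~d a≢b a≢d b≢d a≁b a≁d b≁d =
      proj₁ sat (c , a , b , d , a≢b , a≢d , b≢d , ~⇒≢ c~a , ~⇒≢ c~b , ~⇒≢ c~d ,
                 c~a , c~b , c~d , a≁b , a≁d , b≁d)

    deletion-claw : ∀ {u v} → u ~ v → DeletionClaw u v
    deletion-claw {u} {v} u~v = from-claw (proj₂ sat u v u≢v)
      where
      u≢v = ~⇒≢ u~v
      E′ = toggle (adj G) u v
      keep : ∀ {x y} → E′ x y ≡ true → x ~ y
      keep = untoggle-pair-value u~v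
      leaves : ∀ {c x y w} → SamePair u v x y → c ~ x → c ~ y → c ~ w →
               E′ x w ≡ false → E′ y w ≡ false → w ≢ x → w ≢ y → DeletionClaw u v
      leaves (inj₁ (refl , refl)) c~u c~v c~w uw vw w≢u w≢v =
        _ , c~u , c~v , _ , c~w , adj-sym (untoggle ¬uw uw) , adj-sym (untoggle ¬vw vw) , w≢u , w≢v
        where
        ¬uw = λ q → w≢v (sym (SamePair-functional u≢v (inj₁ (refl , refl)) q))
        ¬vw = λ q → w≢u (sym (SamePair-functional u≢v (inj₂ (refl , refl)) q))
      leaves (inj₂ (refl , refl)) c~v c~u c~w vw uw w≢v w≢u =
        leaves (inj₁ (refl , refl)) c~u c~v c~w uw vw w≢u w≢v
      from-claw : HasInducedClaw E′ → DeletionClaw u v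
      from-claw (c , a , b , d , a≢b , a≢d , b≢d , _ , _ , _ , ca , cb , cd , ab , ad , bd)
        with samePair? u v a b | samePair? u v a d | samePair? u v b d
      ... | yes p | _     | _     =
        leaves p (keep ca) (keep cb) (keep cd) ad bd (a≢d ∘ sym) (b≢d ∘ sym)
      ... | no _  | yes p | _     =
        leaves p (keep ca) (keep cd) (keep cb) ab (trans (toggle-sym d b) bd) (a≢b ∘ sym) b≢d
      ... | no _  | no _  | yes p =
        leaves p (keep cb) (keep cd) (keep ca) (trans (toggle-sym b a) ab) (trans (toggle-sym d a) ad)
               a≢b a≢d
      ... | no ¬p | no ¬q | no ¬r =
        ⊥-elim (claw-free (keep ca) (keep cb) (keep cd) a≢b a≢d b≢d
                          (untoggle ¬p ab) (untoggle ¬q ad) (untoggle ¬r bd))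

    addition-claw : ∀ {u v} → u ≢ v → u ≁ v → AdditionClaw u v ⊎ AdditionClaw v u
    addition-claw {u} {v} u≢v u≁v = from-claw (proj₂ sat u v u≢v)
      where
      E′ = toggle (adj G) u v
      keep : ∀ {x y} → E′ x y ≡ false → x ≁ y
      keep = untoggle-pair-value u≁v
      centre : ∀ {c x y w} → SamePair u v c x → E′ c y ≡ true → E′ c w ≡ true →
               x ≁ y → x ≁ w → y ≁ w → x ≢ y → x ≢ w → y ≢ w → AdditionClaw c x
      centre p cy cw x≁y x≁w y≁w x≢y x≢w y≢w =
        _ , _ , untoggle (λ q → x≢y (SamePair-functional u≢v p q)) cy ,
        untoggle (λ q → x≢w (SamePair-functional u≢v p q)) cw , adj-sym x≁y , adj-sym x≁w , y≁w , y≢w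
      orient : ∀ {c x} → SamePair u v c x → AdditionClaw c x → AdditionClaw u v ⊎ AdditionClaw v u
      orient (inj₁ (refl , refl)) = inj₁
      orient (inj₂ (refl , refl)) = inj₂
      from-claw : HasInducedClaw E′ → AdditionClaw u v ⊎ AdditionClaw v u
      from-claw (c , a , b , d , a≢b , a≢d , b≢d , _ , _ , _ , ca , cb , cd , ab , ad , bd)
        with samePair? u v c a | samePair? u v c b | samePair? u v c d
      ... | yes p | _     | _     =
        orient p (centre p cb cd (keep ab) (keep ad) (keep bd) a≢b a≢d b≢d)
      ... | no _  | yes p | _     =
        orient p (centre p ca cd (adj-sym (keep ab)) (keep bd) (keep ad) (a≢b ∘ sym) b≢d a≢d)
      ... | no _  | no _  | yes p =
        orient p (centre p ca cb (adj-sym (keep ad)) (adj-sym (keep bd)) (keep ab)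
                         (a≢d ∘ sym) (b≢d ∘ sym) a≢b)
      ... | no ¬p | no ¬q | no ¬r =
        ⊥-elim (claw-free (untoggle ¬p ca) (untoggle ¬q cb) (untoggle ¬r cd) a≢b a≢d b≢d
                          (keep ab) (keep ad) (keep bd))

    module _ (reg : Regular 4 G) where

      ≤4-neighbours : ∀ {v ws} → Unique ws → All (v ~_) ws → length ws ≤ 4
      ≤4-neighbours {v} ws! v~ws = subst (_ ≤_) (reg v) (length≤degree ws! v~ws)

      neighbourhood : ∀ {v w ws} → length ws ≡ 4 → Unique ws → All (v ~_) ws → v ~ w → w ∈ ws
      neighbourhood {v} |ws|≡4 = neighbour∈ (≤-reflexive (trans (reg v) (sym |ws|≡4)))

      fourth-neighbour : ∀ v p q r → ∃[ w ] v ~ w × w ∉ p ∷ q ∷ r ∷ []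
      fourth-neighbour v p q r = ∃-neighbour∉ (≤-reflexive (sym (reg v)))

      no-external-neighbour : ∀ {c u v s t} → u ~ v → c ~ u → c ~ v → c ~ s → c ~ t →
                              u ~ s → u ~ t → v ≢ s → v ≢ t → s ≢ t → ¬ ExternalNeighbour c u v
      no-external-neighbour u~v c~u c~v c~s c~t u~s u~t v≢s v≢t s≢t
                            (z , c~z , z≁u , _ , z≢u , z≢v) =
        <-irrefl refl (≤4-neighbours distinct (c~u ∷ c~v ∷ c~s ∷ c~t ∷ c~z ∷ []))
        where
        s≢z = ≁∧~⇒≢ z≁u (adj-sym u~s) ∘ sym
        t≢z = ≁∧~⇒≢ z≁u (adj-sym u~t) ∘ sym
        distinct = (~⇒≢ u~v ∷ ~⇒≢ u~s ∷ ~⇒≢ u~t ∷ z≢u ∘ sym ∷ []) ∷ (v≢s ∷ v≢t ∷ z≢v ∘ sym ∷ [])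
                   ∷ (s≢t ∷ s≢z ∷ []) ∷ (t≢z ∷ []) ∷ [] ∷ []

      common-neighbours-of-non-edge : ∀ {u v ws} → u ≢ v → u ≁ v → Unique ws →
                                      All (u ~_) ws → All (v ~_) ws → length ws ≤ 2
      common-neighbours-of-non-edge {ws = ws} u≢v u≁v ws! u~ws v~ws =
        [ (λ claw → bound claw u~ws v~ws) , (λ claw → bound claw v~ws u~ws) ]′ (addition-claw u≢v u≁v)
        where
        bound : ∀ {x y} → AdditionClaw x y → All (x ~_) ws → All (y ~_) ws → length ws ≤ 2
        bound {y = y} (p , q , x~p , x~q , p≁y , q≁y , _ , p≢q) x~ws y~ws =
          s≤s⁻¹ (s≤s⁻¹ (≤4-neighbours ((p≢q ∷ outside p≁y) ∷ outside q≁y ∷ ws!) (x~p ∷ x~q ∷ x~ws)))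
          where
          outside : ∀ {r} → r ≁ y → All (r ≢_) ws
          outside r≁y = All.map (λ y~w → ≁∧~⇒≢ r≁y (adj-sym y~w)) y~ws

      -- With x the fourth neighbour of a, either the centre of a deletion claw would need
      -- a fifth neighbour, or x and a vertex of the K₄ are non-adjacent with three common
      -- neighbours.
      K4-free : ∀ {a b c d} → a ~ b → a ~ c → a ~ d → b ~ c → b ~ d → c ~ d → ⊥
      K4-free {a} {b} {c} {d} a~b a~c a~d b~c b~d c~d with fourth-neighbour a b c d
      ... | x , a~x , x∉ = cases (~-or-≁ x b) (~-or-≁ x c) (~-or-≁ x d)
        where
        x≢b = x∉ ∘ here
        x≢c = x∉ ∘ there ∘ here
        x≢d = x∉ ∘ there ∘ there ∘ here
        N[a] : ∀ {w} → a ~ w → w ∈ b ∷ c ∷ d ∷ x ∷ []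
        N[a] = neighbourhood refl
          ((~⇒≢ b~c ∷ ~⇒≢ b~d ∷ x≢b ∘ sym ∷ []) ∷ (~⇒≢ c~d ∷ x≢c ∘ sym ∷ []) ∷ (x≢d ∘ sym ∷ []) ∷ [] ∷ [])
          (a~b ∷ a~c ∷ a~d ∷ a~x ∷ [])
        cases : x ~ b ⊎ x ≁ b → x ~ c ⊎ x ≁ c → x ~ d ⊎ x ≁ d → ⊥
        cases (inj₂ x≁b) _ _ with deletion-claw a~x
        ... | _ , e~a , e~x , ext with N[a] (adj-sym e~a)
        ...   | 1st = ~⇒¬≁ (adj-sym e~x) x≁b
        ...   | 2nd = no-external-neighbour a~x e~a e~x (adj-sym b~c) c~d a~b a~d x≢b x≢d (~⇒≢ b~d) ext
        ...   | 3rd = no-external-neighbour a~x e~a e~x (adj-sym b~d) (adj-sym c~d) a~b a~c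
                                              x≢b x≢c (~⇒≢ b~c) ext
        ...   | 4th = ~⇒≢ e~x refl
        cases (inj₁ x~b) (inj₁ x~c) (inj₂ x≁d) =
          <-irrefl refl (common-neighbours-of-non-edge x≢d x≁d
            ((~⇒≢ a~b ∷ ~⇒≢ a~c ∷ []) ∷ (~⇒≢ b~c ∷ []) ∷ [] ∷ [])
            (adj-sym a~x ∷ x~b ∷ x~c ∷ []) (adj-sym a~d ∷ adj-sym b~d ∷ adj-sym c~d ∷ []))
        cases (inj₁ x~b) (inj₂ x≁c) (inj₁ x~d) =
          <-irrefl refl (common-neighbours-of-non-edge x≢c x≁c
            ((~⇒≢ a~b ∷ ~⇒≢ a~d ∷ []) ∷ (~⇒≢ b~d ∷ []) ∷ [] ∷ [])
            (adj-sym a~x ∷ x~b ∷ x~d ∷ []) (adj-sym a~c ∷ adj-sym b~c ∷ c~d ∷ []))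
        cases (inj₁ x~b) (inj₂ x≁c) (inj₂ x≁d) with deletion-claw a~x
        ... | _ , e~a , e~x , ext with N[a] (adj-sym e~a)
        ...   | 1st = no-external-neighbour a~x e~a e~x b~c b~d a~c a~d x≢c x≢d (~⇒≢ c~d) ext
        ...   | 2nd = ~⇒¬≁ (adj-sym e~x) x≁c
        ...   | 3rd = ~⇒¬≁ (adj-sym e~x) x≁d
        ...   | 4th = ~⇒≢ e~x refl
        cases (inj₁ x~b) (inj₁ x~c) (inj₁ x~d) with deletion-claw a~b
        ... | _ , e~a , e~b , ext with N[a] (adj-sym e~a)
        ...   | 1st = ~⇒≢ e~b refl
        ...   | 2nd = no-external-neighbour a~b e~a e~b c~d (adj-sym x~c) a~d a~x
                                              (~⇒≢ b~d) (x≢b ∘ sym) (x≢d ∘ sym) ext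
        ...   | 3rd = no-external-neighbour a~b e~a e~b (adj-sym c~d) (adj-sym x~d) a~c a~x
                                              (~⇒≢ b~c) (x≢b ∘ sym) (x≢c ∘ sym) ext
        ...   | 4th = no-external-neighbour a~b e~a e~b x~c x~d a~c a~d
                                              (~⇒≢ b~c) (~⇒≢ b~d) (~⇒≢ c~d) ext

      common-neighbours-nonadjacent : ∀ {a b c d} → a ~ b → a ~ c → a ~ d → b ~ c → b ~ d → c ≁ d
      common-neighbours-nonadjacent {c = c} {d} a~b a~c a~d b~c b~d with ~-or-≁ c d
      ... | inj₁ c~d = ⊥-elim (K4-free a~b a~c a~d b~c b~d c~d)
      ... | inj₂ c≁d = c≁d

      common-neighbours-of-edge : ∀ {a b ws} → a ~ b → Unique ws →
                                  All (a ~_) ws → All (b ~_) ws → length ws ≤ 2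
      common-neighbours-of-edge _ _ [] _ = z≤n
      common-neighbours-of-edge _ _ (_ ∷ []) _ = s≤s z≤n
      common-neighbours-of-edge _ _ (_ ∷ _ ∷ []) _ = s≤s (s≤s z≤n)
      common-neighbours-of-edge {a} {b} a~b ((c₁≢c₂ ∷ c₁≢c₃ ∷ _) ∷ (c₂≢c₃ ∷ _) ∷ _)
                                        (a~c₁ ∷ a~c₂ ∷ a~c₃ ∷ _) (b~c₁ ∷ b~c₂ ∷ b~c₃ ∷ _) =
        ⊥-elim (claw-free a~c₁ a~c₂ a~c₃ c₁≢c₂ c₁≢c₃ c₂≢c₃ (apart a~c₁ a~c₂ b~c₁ b~c₂)
                          (apart a~c₁ a~c₃ b~c₁ b~c₃) (apart a~c₂ a~c₃ b~c₂ b~c₃))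
        where
        apart : ∀ {c d} → a ~ c → a ~ d → b ~ c → b ~ d → c ≁ d
        apart = common-neighbours-nonadjacent a~b

      -- The triangles abc₁ and abc₂ on the edge ab, with x and y the fourth neighbours
      -- of a and b.
      record Diamond (a b c₁ c₂ x y : Fin n) : Set where
        field
          a~b   : a ~ b
          a~c₁  : a ~ c₁
          a~c₂  : a ~ c₂
          b~c₁  : b ~ c₁
          b~c₂  : b ~ c₂
          c₁≁c₂ : c₁ ≁ c₂
          c₁≢c₂ : c₁ ≢ c₂
          a~x   : a ~ x
          b~y   : b ~ y
          x≁b   : x ≁ b
          y≁a   : y ≁ a
          x≢b   : x ≢ b
          y≢a   : y ≢ a
          x≢c₁  : x ≢ c₁
          x≢c₂  : x ≢ c₂
          y≢c₁  : y ≢ c₁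
          y≢c₂  : y ≢ c₂

      swap-ab : ∀ {a b c₁ c₂ x y} → Diamond a b c₁ c₂ x y → Diamond b a c₁ c₂ y x
      swap-ab D = record
        { a~b = adj-sym a~b ; a~c₁ = b~c₁ ; a~c₂ = b~c₂ ; b~c₁ = a~c₁ ; b~c₂ = a~c₂
        ; c₁≁c₂ = c₁≁c₂ ; c₁≢c₂ = c₁≢c₂ ; a~x = b~y ; b~y = a~x ; x≁b = y≁a ; y≁a = x≁b
        ; x≢b = y≢a ; y≢a = x≢b ; x≢c₁ = y≢c₁ ; x≢c₂ = y≢c₂ ; y≢c₁ = x≢c₁ ; y≢c₂ = x≢c₂ }
        where open Diamond D

      swap-c : ∀ {a b c₁ c₂ x y} → Diamond a b c₁ c₂ x y → Diamond a b c₂ c₁ x y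
      swap-c D = record
        { a~b = a~b ; a~c₁ = a~c₂ ; a~c₂ = a~c₁ ; b~c₁ = b~c₂ ; b~c₂ = b~c₁
        ; c₁≁c₂ = adj-sym c₁≁c₂ ; c₁≢c₂ = c₁≢c₂ ∘ sym ; a~x = a~x ; b~y = b~y ; x≁b = x≁b ; y≁a = y≁a
        ; x≢b = x≢b ; y≢a = y≢a ; x≢c₁ = x≢c₂ ; x≢c₂ = x≢c₁ ; y≢c₁ = y≢c₂ ; y≢c₂ = y≢c₁ }
        where open Diamond D

      a-neighbourhood : ∀ {a b c₁ c₂ x y w} → Diamond a b c₁ c₂ x y → a ~ w → w ∈ b ∷ c₁ ∷ c₂ ∷ x ∷ []
      a-neighbourhood D = neighbourhood refl
        ((~⇒≢ b~c₁ ∷ ~⇒≢ b~c₂ ∷ x≢b ∘ sym ∷ []) ∷ (c₁≢c₂ ∷ x≢c₁ ∘ sym ∷ []) ∷ (x≢c₂ ∘ sym ∷ []) ∷ [] ∷ [])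
        (a~b ∷ a~c₁ ∷ a~c₂ ∷ a~x ∷ [])
        where open Diamond D

      module _ {a b c₁ c₂ x y} (D : Diamond a b c₁ c₂ x y) where
        open Diamond D

        N[a] : ∀ {w} → a ~ w → w ∈ b ∷ c₁ ∷ c₂ ∷ x ∷ []
        N[a] = a-neighbourhood D

        N[b] : ∀ {w} → b ~ w → w ∈ a ∷ c₁ ∷ c₂ ∷ y ∷ []
        N[b] = a-neighbourhood (swap-ab D)

        x-adjacent-to-exactly-one : (x ~ c₁ × x ≁ c₂) ⊎ (x ≁ c₁ × x ~ c₂)
        x-adjacent-to-exactly-one with ~-or-≁ x c₁ | ~-or-≁ x c₂
        ... | inj₁ x~c₁ | inj₁ x~c₂ =
          ⊥-elim (<-irrefl refl (common-neighbours-of-non-edge x≢b x≁b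
            ((~⇒≢ a~c₁ ∷ ~⇒≢ a~c₂ ∷ []) ∷ (c₁≢c₂ ∷ []) ∷ [] ∷ [])
            (adj-sym a~x ∷ x~c₁ ∷ x~c₂ ∷ []) (adj-sym a~b ∷ b~c₁ ∷ b~c₂ ∷ [])))
        ... | inj₁ x~c₁ | inj₂ x≁c₂ = inj₁ (x~c₁ , x≁c₂)
        ... | inj₂ x≁c₁ | inj₁ x~c₂ = inj₂ (x≁c₁ , x~c₂)
        ... | inj₂ x≁c₁ | inj₂ x≁c₂ =
          ⊥-elim (claw-free a~c₁ a~c₂ a~x c₁≢c₂ (x≢c₁ ∘ sym) (x≢c₂ ∘ sym)
                            c₁≁c₂ (adj-sym x≁c₁) (adj-sym x≁c₂))

        no-addition-claw : y ≁ c₁ → ¬ AdditionClaw c₁ c₂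
        no-addition-claw y≁c₁ (p , q , c₁~p , c₁~q , p≁c₂ , q≁c₂ , p≁q , p≢q) =
          claw-free (adj-sym b~c₁) c₁~p c₁~q (≁∧~⇒≢ p≁c₂ b~c₂ ∘ sym) (≁∧~⇒≢ q≁c₂ b~c₂ ∘ sym) p≢q
                    (b≁ c₁~p p≁c₂) (b≁ c₁~q q≁c₂) p≁q
          where
          b≁ : ∀ {r} → c₁ ~ r → r ≁ c₂ → b ≁ r
          b≁ {r} c₁~r r≁c₂ with ~-or-≁ b r
          ... | inj₂ b≁r = b≁r
          ... | inj₁ b~r with N[b] b~r
          ...   | 1st = ⊥-elim (~⇒¬≁ a~c₂ r≁c₂)
          ...   | 2nd = ⊥-elim (~⇒≢ c₁~r refl)
          ...   | 3rd = ⊥-elim (~⇒¬≁ c₁~r c₁≁c₂)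
          ...   | 4th = ⊥-elim (~⇒¬≁ (adj-sym c₁~r) y≁c₁)

        unique-special : x ~ c₁ → x ≁ c₂ → y ~ c₁ → ∃! _≡_ (SpecialTriangle a b)
        unique-special x~c₁ x≁c₂ y~c₁ = c₂ , (a~b , b~c₂ , adj-sym a~c₂ , inj₂ (inj₂ sole)) , unique
          where
          sole : SoleCommonNeighbour c₂ a b
          sole w c₂~w a~w with N[a] a~w
          ... | 1st = refl
          ... | 2nd = ⊥-elim (~⇒¬≁ (adj-sym c₂~w) c₁≁c₂)
          ... | 3rd = ⊥-elim (~⇒≢ c₂~w refl)
          ... | 4th = ⊥-elim (~⇒¬≁ (adj-sym c₂~w) x≁c₂)
          not-special : ¬ SpecialTriangle a b c₁
          not-special (_ , _ , _ , sole₁) =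
            [ (λ s → c₁≢c₂ (sym (s c₂ a~c₂ b~c₂)))
            , [ (λ s → y≢a (s y b~y (adj-sym y~c₁))) , (λ s → x≢b (s x (adj-sym x~c₁) a~x)) ]′ ]′ sole₁
          unique : ∀ {c} → SpecialTriangle a b c → c₂ ≡ c
          unique abc@(_ , b~c , c~a , _) with N[a] (adj-sym c~a)
          ... | 1st = ⊥-elim (~⇒≢ b~c refl)
          ... | 2nd = ⊥-elim (not-special abc)
          ... | 3rd = refl
          ... | 4th = ⊥-elim (~⇒¬≁ (adj-sym b~c) x≁b)

      same-side : ∀ {a b c₁ c₂ x y} → Diamond a b c₁ c₂ x y → x ≁ c₂ → y ≁ c₁ → ⊥
      same-side D x≁c₂ y≁c₁ =
        [ no-addition-claw D y≁c₁ , no-addition-claw (swap-ab (swap-c D)) x≁c₂ ]′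
          (addition-claw (Diamond.c₁≢c₂ D) (Diamond.c₁≁c₂ D))

      -- x and y each see exactly one of c₁, c₂, and the same one; the special triangle on
      -- ab is the one through the other.
      diamond-special : ∀ {a b c₁ c₂ x y} → Diamond a b c₁ c₂ x y → ∃! _≡_ (SpecialTriangle a b)
      diamond-special D with x-adjacent-to-exactly-one D | x-adjacent-to-exactly-one (swap-ab D)
      ... | inj₁ (x~c₁ , x≁c₂) | inj₁ (y~c₁ , _) = unique-special D x~c₁ x≁c₂ y~c₁
      ... | inj₂ (x≁c₁ , x~c₂) | inj₂ (_ , y~c₂) = unique-special (swap-c D) x~c₂ x≁c₁ y~c₂
      ... | inj₁ (_ , x≁c₂) | inj₂ (y≁c₁ , _) = ⊥-elim (same-side D x≁c₂ y≁c₁)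
      ... | inj₂ (x≁c₁ , _) | inj₁ (_ , y≁c₂) = ⊥-elim (same-side (swap-c D) x≁c₁ y≁c₂)

      diamond : ∀ {a b c₁ c₂} → a ~ b → a ~ c₁ → a ~ c₂ → b ~ c₁ → b ~ c₂ → c₁ ≢ c₂ →
                ∃[ x ] ∃[ y ] Diamond a b c₁ c₂ x y
      diamond {a} {b} {c₁} {c₂} a~b a~c₁ a~c₂ b~c₁ b~c₂ c₁≢c₂
        with fourth-neighbour a b c₁ c₂ | fourth-neighbour b a c₁ c₂
      ... | x , a~x , x∉ | y , b~y , y∉ = x , y , record
        { a~b = a~b ; a~c₁ = a~c₁ ; a~c₂ = a~c₂ ; b~c₁ = b~c₁ ; b~c₂ = b~c₂
        ; c₁≁c₂ = common-neighbours-nonadjacent a~b a~c₁ a~c₂ b~c₁ b~c₂ ; c₁≢c₂ = c₁≢c₂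
        ; a~x = a~x ; b~y = b~y
        ; x≁b = third-common a~b a~c₁ a~c₂ b~c₁ b~c₂ a~x (x∉ ∘ there ∘ here) (x∉ ∘ there ∘ there ∘ here)
        ; y≁a = third-common (adj-sym a~b) b~c₁ b~c₂ a~c₁ a~c₂ b~y
                             (y∉ ∘ there ∘ here) (y∉ ∘ there ∘ there ∘ here)
        ; x≢b = x∉ ∘ here ; y≢a = y∉ ∘ here
        ; x≢c₁ = x∉ ∘ there ∘ here ; x≢c₂ = x∉ ∘ there ∘ there ∘ here
        ; y≢c₁ = y∉ ∘ there ∘ here ; y≢c₂ = y∉ ∘ there ∘ there ∘ here }
        where
        third-common : ∀ {u v w} → u ~ v → u ~ c₁ → u ~ c₂ → v ~ c₁ → v ~ c₂ →
                       u ~ w → w ≢ c₁ → w ≢ c₂ → w ≁ v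
        third-common {v = v} {w} u~v u~c₁ u~c₂ v~c₁ v~c₂ u~w w≢c₁ w≢c₂ with ~-or-≁ w v
        ... | inj₂ w≁v = w≁v
        ... | inj₁ w~v = ⊥-elim (<-irrefl refl (common-neighbours-of-edge u~v
                           ((c₁≢c₂ ∷ w≢c₁ ∘ sym ∷ []) ∷ (w≢c₂ ∘ sym ∷ []) ∷ [] ∷ [])
                           (u~c₁ ∷ u~c₂ ∷ u~w ∷ []) (v~c₁ ∷ v~c₂ ∷ adj-sym w~v ∷ [])))

      special-triangle : ∀ {a b} → a ~ b → ∃! _≡_ (SpecialTriangle a b)
      special-triangle {a} {b} a~b with deletion-claw a~b
      ... | c₁ , c₁~a , c₁~b , _ with any? (λ w → a ~? w ×-dec b ~? w ×-dec ¬? (w ≟ c₁))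
      ...   | yes (c₂ , a~c₂ , b~c₂ , c₂≢c₁) =
        let _ , _ , D = diamond a~b (adj-sym c₁~a) a~c₂ (adj-sym c₁~b) b~c₂ (c₂≢c₁ ∘ sym)
        in diamond-special D
      ...   | no ¬c₂ =
        c₁ , (a~b , adj-sym c₁~b , c₁~a , inj₁ sole) , λ (_ , b~c , c~a , _) → sym (sole _ (adj-sym c~a) b~c)
        where
        sole : SoleCommonNeighbour a b c₁
        sole w a~w b~w with w ≟ c₁
        ... | yes w≡c₁ = w≡c₁
        ... | no  w≢c₁ = ⊥-elim (¬c₂ (w , a~w , b~w , w≢c₁))

      special-count : ∀ a b → ∑[ c < n ] 𝟙 (does (special? a b c)) ≡ 𝟙 (adj G a b)
      special-count a b with ~-or-≁ a b
      ... | inj₁ a~b with special-triangle a~b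
      ...   | c , abc , unique = begin
        ∑[ c′ < n ] 𝟙 (does (special? a b c′)) ≡⟨ ∑-supported-at _ c off-c ⟩
        𝟙 (does (special? a b c))              ≡⟨ cong 𝟙 (dec-true (special? a b c) abc) ⟩
        1                                      ≡⟨ cong 𝟙 a~b ⟨
        𝟙 (adj G a b)                          ∎
        where
        open ≡-Reasoning
        off-c : ∀ c′ → c′ ≢ c → 𝟙 (does (special? a b c′)) ≡ 0
        off-c c′ c′≢c = cong 𝟙 (dec-false (special? a b c′) (c′≢c ∘ sym ∘ unique))
      special-count a b | inj₂ a≁b =
        trans (sum-cong-≗ λ c → cong 𝟙 (dec-false (special? a b c) λ (a~b , _) → ~⇒¬≁ a~b a≁b))
              (trans (sum-replicate-zero n) (cong 𝟙 (sym a≁b)))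

      ∑³-special : ∑³ (λ a b c → 𝟙 (does (special? a b c))) ≡ n * 4
      ∑³-special = begin
        ∑³ (λ a b c → 𝟙 (does (special? a b c))) ≡⟨ sum-cong-≗ (λ a → sum-cong-≗ (special-count a)) ⟩
        ∑[ a < n ] ∑[ b < n ] 𝟙 (adj G a b)        ≡⟨ sum-cong-≗ (λ a → trans (sym (degree≡∑ a)) (reg a)) ⟩
        ∑[ a < n ] 4                              ≡⟨ ∑-const n 4 ⟩
        n * 4                                     ∎
        where open ≡-Reasoning

proposition4p7 : (n : ℕ) (G : Graph n) → Regular 4 G → ClawInducedSaturated G
    → n % 3 ≡ 0
proposition4p7 n G reg sat = n∣m⇒m%n≡0 n 3 (3∣n*4⇒3∣n n 3∣n*4)
  where
  3∣n*4 : 3 ∣ n * 4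
  3∣n*4 = subst (3 ∣_) (∑³-special G sat reg) (3∣∑³-special G)
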